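{- Let $k\ge 1$ be an integer and $m\ge 1$. Then \[ \sum_{q=0}^{m-1}\binom{m}{q}(m-q)B_q^{(k)}B_{m-q}^{(-k)}=\begin{cases}-kB_1, & m=1,\\ kB_m, & m\ge 2,\end{cases} \] and, for $m\ge 2$, \[ \sum_{q=0}^{m-2}\binom{m}{q}(m-q)(m-q-1)B_q^{(k)}B_{m-q}^{(-k)}=\begin{cases}-k(3k-1)B_2-2k^2B_1, & m=2,\\ -k\big((m+1)k-m+1\big)B_m+mk^2B_{m-1}, & m\ge 3.\end{cases} \]
   Context: For any integer $j$ (positive, zero or negative), the numbers $B^{(j)}_q$ are defined by the exponential generating function $\frac{t^j}{(e^t-1)^j}=\sum_{q\ge0}B^{(j)}_q\frac{t^q}{q!}$; in particular $B^{(-k)}_q$ are the coefficients of $\big(\frac{e^t-1}{t}\big)^k$. $B_q=B^{(1)}_q$ are the classical Bernoulli numbers, defined by $\frac{t}{e^t-1}=\sum_{q\ge0}B_q\frac{t^q}{q!}$ (so $B_1=-1/2$). -}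

module Defs where

open import Data.Nat as ℕ using (ℕ; zero; suc; _≤ᵇ_)
open import Data.Nat.Combinatorics using (_C_)
open import Data.Integer as ℤ using (ℤ; +_; -[1+_])
open import Data.Rational as ℚ using (ℚ; _+_; _*_; -_; _/_; 0ℚ; 1ℚ)
open import Data.Bool using (if_then_else_)

ℕtoℚ : ℕ → ℚ
ℕtoℚ n = (+ n) / 1

sumBelow : ℕ → (ℕ → ℚ) → ℚ
sumBelow zero    f = 0ℚ
sumBelow (suc n) f = sumBelow n f + f n

-- Exponential generating functions are represented by their EGF coefficient
-- sequences a : ℕ → ℚ, meaning Σ a n tⁿ/n!.
-- Product of EGFs: (a·b)_n = Σ_{i=0}^{n} C(n,i) a_i b_{n-i}.
egfMul : (ℕ → ℚ) → (ℕ → ℚ) → ℕ → ℚ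
egfMul a b n = sumBelow (suc n) (λ i → ℕtoℚ (n C i) * (a i * b (n ℕ.∸ i)))

egfOne : ℕ → ℚ
egfOne zero    = 1ℚ
egfOne (suc _) = 0ℚ

egfPow : (ℕ → ℚ) → ℕ → ℕ → ℚ
egfPow a zero    = egfOne
egfPow a (suc k) = egfMul a (egfPow a k)

-- (e^t - 1)/t = Σ tⁿ/(n+1)!, so its n-th EGF coefficient is n!/(n+1)! = 1/(n+1).
expm1Overt : ℕ → ℚ
expm1Overt n = (+ 1) / suc n

-- Multiplicative inverse of an EGF a with a 0 = 1:
-- the unique b with (a·b)_0 = 1 and (a·b)_n = 0 for n ≥ 1, i.e.
-- b 0 = 1, b n = - Σ_{i<n} C(n,i) b_i a_{n-i}.
-- invUpTo a n agrees with the inverse on all indices ≤ n.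
invUpTo : (ℕ → ℚ) → ℕ → ℕ → ℚ
invUpTo a zero = egfOne
invUpTo a (suc n) i =
  if i ≤ᵇ n then g i
  else - sumBelow (suc n) (λ j → ℕtoℚ (suc n C j) * (g j * a (suc n ℕ.∸ j)))
  where
  g = invUpTo a n

egfInv : (ℕ → ℚ) → ℕ → ℚ
egfInv a n = invUpTo a n n

-- Classical Bernoulli numbers: t/(e^t-1) = 1 / ((e^t-1)/t) = Σ B_q t^q/q!  (B 1 = -1/2).
B : ℕ → ℚ
B = egfInv expm1Overt

-- Bernoulli numbers of order j ∈ ℤ: t^j/(e^t-1)^j = Σ B^{(j)}_q t^q/q!.
-- For j = k ≥ 0 this is (t/(e^t-1))^k; for j = -k < 0 it is ((e^t-1)/t)^k.
Bord : ℤ → ℕ → ℚ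
Bord (+ k)     = egfPow B k
Bord -[1+ k ]  = egfPow expm1Overt (suc k)

-- Idea.  Work in the ring of exponential generating functions, represented
-- by coefficient sequences with the binomial convolution ⊛ as product.  Let
-- θ = t·d/dt, (θ a)_n = n·a_n, a derivation of this ring, and let g, f be
-- mutually inverse series (here g = t/(e^t-1) and f = (e^t-1)/t).  With
-- h = g·θf the Leibniz rule gives, by induction on k,
--     g^k·θ(f^k)  = k·h,        g^k·θ²(f^k) = k·g·θ²f + k(k-1)·h².
-- The left sides are exactly the sums of the theorem (after discarding
-- vanishing terms), so it remains to express h, g·θ²f and h² through B:
-- from θf = e^t - f and e^t = 1 + t·f one gets h = B + t - 1,
-- g·θ²f = t·(h + 1) - h and h² = -θB + t·h - h; reading off the m-th
-- coefficient yields the four cases of the theorem.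
module Submission where

open import Defs
open import Data.Nat as ℕ using (ℕ; _≤_; _∸_)
open import Data.Nat.Combinatorics using (_C_)
open import Data.Integer as ℤ using (+_)
open import Data.Rational as ℚ using (ℚ; _*_; -_; _+_)
open import Data.Product using (_×_)
open import Relation.Binary.PropositionalEquality using (_≡_)

open import Data.Nat using (zero; suc; _<_; _!; s≤s; NonZero)
open import Data.Rational using (0ℚ; 1ℚ)
open import Data.Nat.Combinatorics using (nCk≡nC[n∸k]; nCn≡1; nCk≡n!/k![n-k]!; k![n∸k]!∣n!)
import Data.Nat.Properties as ℕP
import Data.Nat.Solver as ℕSolver
import Data.Nat.Coprimality as Coprimality
import Data.Nat.DivMod as DivMod
import Data.Integer.Properties as ℤP
import Data.Integer.Solver as ℤSolver
import Data.Rational.Properties as ℚP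
import Data.Rational.Unnormalised as ℚᵘ
import Data.Rational.Unnormalised.Properties as ℚᵘP
import Data.Rational.Solver as ℚSolver
open import Data.Bool as Bool using (true; false; if_then_else_)
open import Data.Empty using (⊥-elim)
open import Data.Unit using (tt)
open import Data.Sum using (inj₁; inj₂)
open import Data.Product using (_,_)
open import Data.Maybe using (Maybe; just; nothing)
open import Relation.Nullary using (yes; no)
open import Relation.Binary.PropositionalEquality
  using (refl; sym; trans; cong; cong₂; subst; module ≡-Reasoning)
open import Relation.Binary.Structures using (IsEquivalence)
open import Relation.Binary.Bundles using (Setoid)
import Relation.Binary.Reasoning.Setoid as SetoidReasoning
import Algebra.Structures.Biased as Biased
open import Algebra.Solver.Ring.AlmostCommutativeRing
  using (AlmostCommutativeRing; _-Raw-AlmostCommutative⟶_)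
import Algebra.Solver.Ring as RingSolver

module _ where
  open ≡-Reasoning
  open ℚSolver.+-*-Solver

  sum-cong : ∀ n {f g : ℕ → ℚ} → (∀ i → i < n → f i ≡ g i) → sumBelow n f ≡ sumBelow n g
  sum-cong zero    f≡g = refl
  sum-cong (suc n) f≡g =
    cong₂ _+_ (sum-cong n (λ i i<n → f≡g i (ℕP.m<n⇒m<1+n i<n))) (f≡g n ℕP.≤-refl)

  sum-ext : ∀ n {f g : ℕ → ℚ} → (∀ i → f i ≡ g i) → sumBelow n f ≡ sumBelow n g
  sum-ext n f≡g = sum-cong n (λ i _ → f≡g i)

  sum-zero : ∀ n {f : ℕ → ℚ} → (∀ i → i < n → f i ≡ 0ℚ) → sumBelow n f ≡ 0ℚ
  sum-zero zero    f≡0 = refl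
  sum-zero (suc n) f≡0 =
    cong₂ _+_ (sum-zero n (λ i i<n → f≡0 i (ℕP.m<n⇒m<1+n i<n))) (f≡0 n ℕP.≤-refl)

  sum-+ : ∀ n (f g : ℕ → ℚ) → sumBelow n (λ i → f i + g i) ≡ sumBelow n f + sumBelow n g
  sum-+ zero    f g = refl
  sum-+ (suc n) f g = begin
    sumBelow n (λ i → f i + g i) + (f n + g n)   ≡⟨ cong (_+ (f n + g n)) (sum-+ n f g) ⟩
    (sumBelow n f + sumBelow n g) + (f n + g n)
      ≡⟨ solve 4 (λ a b c d → (a :+ b) :+ (c :+ d) := (a :+ c) :+ (b :+ d)) refl
               (sumBelow n f) (sumBelow n g) (f n) (g n) ⟩
    (sumBelow n f + f n) + (sumBelow n g + g n)  ∎

  sum-*ˡ : ∀ n c (f : ℕ → ℚ) → sumBelow n (λ i → c * f i) ≡ c * sumBelow n f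
  sum-*ˡ zero    c f = sym (ℚP.*-zeroʳ c)
  sum-*ˡ (suc n) c f = begin
    sumBelow n (λ i → c * f i) + c * f n ≡⟨ cong (_+ c * f n) (sum-*ˡ n c f) ⟩
    c * sumBelow n f + c * f n           ≡⟨ ℚP.*-distribˡ-+ c (sumBelow n f) (f n) ⟨
    c * (sumBelow n f + f n)             ∎

  sum-*ʳ : ∀ n (f : ℕ → ℚ) c → sumBelow n (λ i → f i * c) ≡ sumBelow n f * c
  sum-*ʳ zero    f c = sym (ℚP.*-zeroˡ c)
  sum-*ʳ (suc n) f c = begin
    sumBelow n (λ i → f i * c) + f n * c ≡⟨ cong (_+ f n * c) (sum-*ʳ n f c) ⟩
    sumBelow n f * c + f n * c           ≡⟨ ℚP.*-distribʳ-+ c (sumBelow n f) (f n) ⟨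
    (sumBelow n f + f n) * c             ∎

  sum-neg : ∀ n (f : ℕ → ℚ) → sumBelow n (λ i → - f i) ≡ - sumBelow n f
  sum-neg zero    f = refl
  sum-neg (suc n) f =
    trans (cong (_+ (- f n)) (sum-neg n f)) (sym (ℚP.neg-distrib-+ (sumBelow n f) (f n)))

  sum-peel : ∀ n (f : ℕ → ℚ) → sumBelow (suc n) f ≡ f 0 + sumBelow n (λ i → f (suc i))
  sum-peel zero    f = trans (ℚP.+-identityˡ (f 0)) (sym (ℚP.+-identityʳ (f 0)))
  sum-peel (suc n) f = begin
    sumBelow (suc n) f + f (suc n)                     ≡⟨ cong (_+ f (suc n)) (sum-peel n f) ⟩
    (f 0 + sumBelow n (λ i → f (suc i))) + f (suc n)   ≡⟨ ℚP.+-assoc (f 0) _ (f (suc n)) ⟩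
    f 0 + (sumBelow n (λ i → f (suc i)) + f (suc n))   ∎

  sum-reverse : ∀ n (f : ℕ → ℚ) → sumBelow n f ≡ sumBelow n (λ i → f (n ∸ suc i))
  sum-reverse zero    f = refl
  sum-reverse (suc n) f = begin
    sumBelow n f + f n                       ≡⟨ cong (_+ f n) (sum-reverse n f) ⟩
    sumBelow n (λ i → f (n ∸ suc i)) + f n   ≡⟨ ℚP.+-comm _ (f n) ⟩
    f n + sumBelow n (λ i → f (n ∸ suc i))   ≡⟨ sum-peel n (λ i → f (suc n ∸ suc i)) ⟨
    sumBelow (suc n) (λ i → f (suc n ∸ suc i)) ∎

  -- Exchanging the order of summation over the triangle 0 ≤ j ≤ i < n,
  -- with the outer index written as i = j + l.
  sum-triangle : ∀ n (F : ℕ → ℕ → ℚ) →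
    sumBelow n (λ i → sumBelow (suc i) (F i)) ≡
    sumBelow n (λ j → sumBelow (n ∸ j) (λ l → F (j ℕ.+ l) j))
  sum-triangle zero    F = refl
  sum-triangle (suc n) F = begin
    sumBelow n (λ i → sumBelow (suc i) (F i)) + sumBelow (suc n) (F n)
      ≡⟨ cong₂ _+_ (sum-triangle n F) (sum-cong (suc n) (λ j j≤n → cong (λ i → F i j) (sym (j+[n∸j] j≤n)))) ⟩
    Inner n + sumBelow (suc n) Diagonal
      ≡⟨ cong (_+ sumBelow (suc n) Diagonal) (sym emptyLast) ⟩
    (Inner n + sumBelow (n ∸ n) (λ l → F (n ℕ.+ l) n)) + sumBelow (suc n) Diagonal
      ≡⟨ sum-+ (suc n) _ Diagonal ⟨
    sumBelow (suc n) (λ j → sumBelow (n ∸ j) (λ l → F (j ℕ.+ l) j) + Diagonal j)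
      ≡⟨ sum-cong (suc n) (λ j j≤n → cong (λ d → sumBelow d (λ l → F (j ℕ.+ l) j))
                                          (sym (ℕP.+-∸-assoc 1 (ℕP.≤-pred j≤n)))) ⟩
    sumBelow (suc n) (λ j → sumBelow (suc n ∸ j) (λ l → F (j ℕ.+ l) j)) ∎
    where
    j+[n∸j] : ∀ {j} → j < suc n → j ℕ.+ (n ∸ j) ≡ n
    j+[n∸j] j≤n = ℕP.m+[n∸m]≡n (ℕP.≤-pred j≤n)
    Inner : ℕ → ℚ
    Inner m = sumBelow m (λ j → sumBelow (n ∸ j) (λ l → F (j ℕ.+ l) j))
    Diagonal : ℕ → ℚ
    Diagonal j = F (j ℕ.+ (n ∸ j)) j
    emptyLast : Inner n + sumBelow (n ∸ n) (λ l → F (n ℕ.+ l) n) ≡ Inner n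
    emptyLast = trans (cong (λ d → Inner n + sumBelow d (λ l → F (n ℕ.+ l) n)) (ℕP.n∸n≡0 n))
                      (ℚP.+-identityʳ (Inner n))

-- The embedding ℕ → ℚ is a semiring homomorphism; it is computed through
-- unnormalised rationals, where n ↦ n/1 is visibly additive and multiplicative.
module _ where
  open ℤSolver.+-*-Solver

  ℕtoℚ-normal : ∀ n → ℚ.toℚᵘ (ℕtoℚ n) ≡ ℚᵘ.mkℚᵘ (+ n) 0
  ℕtoℚ-normal n = cong ℚ.toℚᵘ (ℚP.normalize-coprime (Coprimality.sym (Coprimality.1-coprimeTo n)))

  ℕtoℚ-≃ : ∀ n x → ℚᵘ.mkℚᵘ (+ n) 0 ℚᵘ.≃ ℚ.toℚᵘ x → ℕtoℚ n ≡ x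
  ℕtoℚ-≃ n x eq = ℚP.toℚᵘ-injective (ℚᵘP.≃-trans (ℚᵘP.≃-reflexive (ℕtoℚ-normal n)) eq)

  ℕtoℚ-+ : ∀ a b → ℕtoℚ (a ℕ.+ b) ≡ ℕtoℚ a + ℕtoℚ b
  ℕtoℚ-+ a b = ℕtoℚ-≃ (a ℕ.+ b) _ (ℚᵘP.≃-trans sum/1 (ℚᵘP.≃-sym (ℚᵘP.≃-trans
    (ℚP.toℚᵘ-homo-+ (ℕtoℚ a) (ℕtoℚ b))
    (ℚᵘP.≃-reflexive (cong₂ ℚᵘ._+_ (ℕtoℚ-normal a) (ℕtoℚ-normal b))))))
    where
    sum/1 : ℚᵘ.mkℚᵘ (+ (a ℕ.+ b)) 0 ℚᵘ.≃ ℚᵘ.mkℚᵘ (+ a) 0 ℚᵘ.+ ℚᵘ.mkℚᵘ (+ b) 0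
    sum/1 = ℚᵘ.*≡* (solve 2 (λ x y → (x :+ y) :* con (+ 1) := (x :* con (+ 1) :+ y :* con (+ 1)) :* con (+ 1))
                          refl (+ a) (+ b))

  ℕtoℚ-* : ∀ a b → ℕtoℚ (a ℕ.* b) ≡ ℕtoℚ a * ℕtoℚ b
  ℕtoℚ-* a b = ℕtoℚ-≃ (a ℕ.* b) _ (ℚᵘP.≃-trans product/1 (ℚᵘP.≃-sym (ℚᵘP.≃-trans
    (ℚP.toℚᵘ-homo-* (ℕtoℚ a) (ℕtoℚ b))
    (ℚᵘP.≃-reflexive (cong₂ ℚᵘ._*_ (ℕtoℚ-normal a) (ℕtoℚ-normal b))))))
    where
    product/1 : ℚᵘ.mkℚᵘ (+ (a ℕ.* b)) 0 ℚᵘ.≃ ℚᵘ.mkℚᵘ (+ a) 0 ℚᵘ.* ℚᵘ.mkℚᵘ (+ b) 0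
    product/1 = ℚᵘ.*≡* (trans (cong (ℤ._* + 1) (ℤP.pos-* a b))
      (solve 2 (λ x y → (x :* y) :* con (+ 1) := (x :* y) :* con (+ 1)) refl (+ a) (+ b)))

  ℕtoℚ-suc : ∀ n → ℕtoℚ (suc n) ≡ 1ℚ + ℕtoℚ n
  ℕtoℚ-suc n = ℕtoℚ-+ 1 n

  expm1Overt-inverse : ∀ n → ℕtoℚ (suc n) * expm1Overt n ≡ 1ℚ
  expm1Overt-inverse n = ℚP.toℚᵘ-injective (ℚᵘP.≃-trans (ℚP.toℚᵘ-homo-* (ℕtoℚ (suc n)) (expm1Overt n))
    (ℚᵘP.≃-trans (ℚᵘP.≃-reflexive (cong₂ ℚᵘ._*_ (ℕtoℚ-normal (suc n)) coeff-normal)) cancel))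
    where
    coeff-normal : ℚ.toℚᵘ (expm1Overt n) ≡ ℚᵘ.mkℚᵘ (+ 1) n
    coeff-normal = cong ℚ.toℚᵘ (ℚP.normalize-coprime (Coprimality.1-coprimeTo (suc n)))
    cancel : ℚᵘ.mkℚᵘ (+ suc n) 0 ℚᵘ.* ℚᵘ.mkℚᵘ (+ 1) n ℚᵘ.≃ ℚᵘ.mkℚᵘ (+ 1) 0
    cancel = ℚᵘ.*≡* (solve 1 (λ x → ((con (+ 1) :+ x) :* con (+ 1)) :* con (+ 1)
                                  := con (+ 1) :* (con (+ 1) :* (con (+ 1) :+ x))) refl (+ n))

module _ where
  open ≡-Reasoning
  open ℕSolver.+-*-Solver
  open ℕP using (_!≢0; _!*_!≢0)

  binomial-factorial : ∀ {n k} → k ≤ n → (n C k) ℕ.* (k ! ℕ.* (n ∸ k) !) ≡ n !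
  binomial-factorial {n} {k} k≤n =
    trans (cong (ℕ._* (k ! ℕ.* (n ∸ k) !)) (nCk≡n!/k![n-k]! k≤n))
          (DivMod.m/n*n≡m {{k !* (n ∸ k) !≢0}} (k![n∸k]!∣n! k≤n))

  binomial-subset : ∀ {n k j} → j ≤ k → k ≤ n →
                    (n C k) ℕ.* (k C j) ≡ (n C j) ℕ.* ((n ∸ j) C (k ∸ j))
  binomial-subset {n} {k} {j} j≤k k≤n = ℕP.*-cancelʳ-≡ _ _ (j ! ℕ.* ((k ∸ j) ! ℕ.* (n ∸ k) !)) {{denominator≢0}} (begin
      (n C k) ℕ.* (k C j) ℕ.* (j ! ℕ.* ((k ∸ j) ! ℕ.* (n ∸ k) !))
        ≡⟨ solve 5 (λ a b c d e → a :* b :* (c :* (d :* e)) := a :* (b :* (c :* d)) :* e) refl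
                 (n C k) (k C j) (j !) ((k ∸ j) !) ((n ∸ k) !) ⟩
      (n C k) ℕ.* ((k C j) ℕ.* (j ! ℕ.* (k ∸ j) !)) ℕ.* (n ∸ k) !
        ≡⟨ cong (λ x → (n C k) ℕ.* x ℕ.* (n ∸ k) !) (binomial-factorial j≤k) ⟩
      (n C k) ℕ.* k ! ℕ.* (n ∸ k) !
        ≡⟨ trans (ℕP.*-assoc (n C k) (k !) _) (binomial-factorial k≤n) ⟩
      n !
        ≡⟨ binomial-factorial (ℕP.≤-trans j≤k k≤n) ⟨
      (n C j) ℕ.* (j ! ℕ.* (n ∸ j) !)
        ≡⟨ cong (λ x → (n C j) ℕ.* (j ! ℕ.* x)) (binomial-factorial (ℕP.∸-monoˡ-≤ j k≤n)) ⟨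
      (n C j) ℕ.* (j ! ℕ.* (((n ∸ j) C (k ∸ j)) ℕ.* ((k ∸ j) ! ℕ.* (n ∸ j ∸ (k ∸ j)) !)))
        ≡⟨ cong (λ x → (n C j) ℕ.* (j ! ℕ.* (((n ∸ j) C (k ∸ j)) ℕ.* ((k ∸ j) ! ℕ.* x !)))) complement ⟩
      (n C j) ℕ.* (j ! ℕ.* (((n ∸ j) C (k ∸ j)) ℕ.* ((k ∸ j) ! ℕ.* (n ∸ k) !)))
        ≡⟨ solve 5 (λ a b c d e → a :* (b :* (c :* (d :* e))) := a :* c :* (b :* (d :* e))) refl
                 (n C j) (j !) ((n ∸ j) C (k ∸ j)) ((k ∸ j) !) ((n ∸ k) !) ⟩
      (n C j) ℕ.* ((n ∸ j) C (k ∸ j)) ℕ.* (j ! ℕ.* ((k ∸ j) ! ℕ.* (n ∸ k) !)) ∎)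
    where
    denominator≢0 : NonZero (j ! ℕ.* ((k ∸ j) ! ℕ.* (n ∸ k) !))
    denominator≢0 = ℕP.m*n≢0 _ _ {{j !≢0}} {{(k ∸ j) !* (n ∸ k) !≢0}}
    complement : n ∸ j ∸ (k ∸ j) ≡ n ∸ k
    complement = trans (ℕP.∸-+-assoc n j (k ∸ j)) (cong (n ∸_) (ℕP.m+[n∸m]≡n j≤k))

  binomial-absorption : ∀ {n i} → i ≤ n → (suc n C i) ℕ.* (suc n ∸ i) ≡ suc n ℕ.* (n C i)
  binomial-absorption {n} {i} i≤n = ℕP.*-cancelʳ-≡ _ _ (i ! ℕ.* (n ∸ i) !) {{i !* (n ∸ i) !≢0}} (begin
      (suc n C i) ℕ.* (suc n ∸ i) ℕ.* (i ! ℕ.* (n ∸ i) !)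
        ≡⟨ cong (λ x → (suc n C i) ℕ.* x ℕ.* (i ! ℕ.* (n ∸ i) !)) 1+n∸i ⟩
      (suc n C i) ℕ.* suc (n ∸ i) ℕ.* (i ! ℕ.* (n ∸ i) !)
        ≡⟨ solve 4 (λ a b c d → a :* b :* (c :* d) := a :* (c :* (b :* d))) refl
                 (suc n C i) (suc (n ∸ i)) (i !) ((n ∸ i) !) ⟩
      (suc n C i) ℕ.* (i ! ℕ.* (suc (n ∸ i)) !)
        ≡⟨ cong (λ x → (suc n C i) ℕ.* (i ! ℕ.* x !)) 1+n∸i ⟨
      (suc n C i) ℕ.* (i ! ℕ.* (suc n ∸ i) !)
        ≡⟨ binomial-factorial (ℕP.m≤n⇒m≤1+n i≤n) ⟩
      suc n ℕ.* n !
        ≡⟨ cong (suc n ℕ.*_) (binomial-factorial i≤n) ⟨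
      suc n ℕ.* ((n C i) ℕ.* (i ! ℕ.* (n ∸ i) !))
        ≡⟨ ℕP.*-assoc (suc n) (n C i) _ ⟨
      suc n ℕ.* (n C i) ℕ.* (i ! ℕ.* (n ∸ i) !) ∎)
    where
    1+n∸i : suc n ∸ i ≡ suc (n ∸ i)
    1+n∸i = ℕP.+-∸-assoc 1 i≤n

Seq : Set
Seq = ℕ → ℚ

infix  4 _≐_
infixl 6 _⊕_
infixl 7 _⊛_

_≐_ : Seq → Seq → Set
a ≐ b = ∀ n → a n ≡ b n

_⊕_ : Seq → Seq → Seq
(a ⊕ b) n = a n + b n

_⊛_ : Seq → Seq → Seq
_⊛_ = egfMul

neg : Seq → Seq
neg a n = - a n

ι : ℚ → Seq
ι c zero    = c
ι c (suc _) = 0ℚ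

𝟘 𝟙 : Seq
𝟘 = ι 0ℚ
𝟙 = ι 1ℚ

binom : ℕ → ℕ → ℚ
binom n i = ℕtoℚ (n C i)

≐-isEquivalence : IsEquivalence _≐_
≐-isEquivalence = record
  { refl = λ _ → refl ; sym = λ p n → sym (p n) ; trans = λ p q n → trans (p n) (q n) }

≐-refl : ∀ {a} → a ≐ a
≐-refl _ = refl

SeqSetoid : Setoid _ _
SeqSetoid = record { Carrier = Seq ; _≈_ = _≐_ ; isEquivalence = ≐-isEquivalence }

egfOne≐𝟙 : egfOne ≐ 𝟙
egfOne≐𝟙 zero    = refl
egfOne≐𝟙 (suc n) = refl

⊕-cong : ∀ {a a′ b b′} → a ≐ a′ → b ≐ b′ → a ⊕ b ≐ a′ ⊕ b′
⊕-cong p q n = cong₂ _+_ (p n) (q n)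

⊛-cong : ∀ {a a′ b b′} → a ≐ a′ → b ≐ b′ → a ⊛ b ≐ a′ ⊛ b′
⊛-cong p q n =
  sum-ext (suc n) (λ i → cong₂ (λ x y → binom n i * (x * y)) (p i) (q (n ∸ i)))

neg-cong : ∀ {a a′} → a ≐ a′ → neg a ≐ neg a′
neg-cong p n = cong -_ (p n)

ι-⊛ : ∀ c a → ι c ⊛ a ≐ λ n → c * a n
ι-⊛ c a n = begin
  sumBelow (suc n) (λ i → binom n i * (ι c i * a (n ∸ i)))
    ≡⟨ sum-peel n _ ⟩
  1ℚ * (c * a n) + sumBelow n (λ i → binom n (suc i) * (0ℚ * a (n ∸ suc i)))
    ≡⟨ cong₂ _+_ (ℚP.*-identityˡ (c * a n)) (sum-zero n (λ i _ → vanish i)) ⟩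
  c * a n + 0ℚ
    ≡⟨ ℚP.+-identityʳ (c * a n) ⟩
  c * a n ∎
  where
  open ≡-Reasoning
  vanish : ∀ i → binom n (suc i) * (0ℚ * a (n ∸ suc i)) ≡ 0ℚ
  vanish i = trans (cong (binom n (suc i) *_) (ℚP.*-zeroˡ (a (n ∸ suc i)))) (ℚP.*-zeroʳ (binom n (suc i)))

-- Commutativity: reverse the convolution sum and use C(n,i) = C(n,n-i).
⊛-comm : ∀ a b → a ⊛ b ≐ b ⊛ a
⊛-comm a b n = trans (sum-reverse (suc n) _) (sum-cong (suc n) (λ i i≤n → swap i (ℕP.≤-pred i≤n)))
  where
  swap : ∀ i → i ≤ n → binom n (n ∸ i) * (a (n ∸ i) * b (n ∸ (n ∸ i))) ≡ binom n i * (b i * a (n ∸ i))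
  swap i i≤n = trans (cong₂ (λ x y → ℕtoℚ x * (a (n ∸ i) * b y)) (sym (nCk≡nC[n∸k] i≤n)) (ℕP.m∸[m∸n]≡n i≤n))
                     (cong (binom n i *_) (ℚP.*-comm (a (n ∸ i)) (b i)))

⊛-distribʳ : ∀ a b c → (a ⊕ b) ⊛ c ≐ a ⊛ c ⊕ b ⊛ c
⊛-distribʳ a b c n = trans (sum-ext (suc n) (λ i → distrib (binom n i) (a i) (b i) (c (n ∸ i)))) (sum-+ (suc n) _ _)
  where
  open ℚSolver.+-*-Solver
  distrib : ∀ x y z w → x * ((y + z) * w) ≡ x * (y * w) + x * (z * w)
  distrib = solve 4 (λ x y z w → x :* ((y :+ z) :* w) := x :* (y :* w) :+ x :* (z :* w)) refl

neg-⊛ : ∀ a b → neg a ⊛ b ≐ neg (a ⊛ b)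
neg-⊛ a b n = trans (sum-ext (suc n) negate) (sum-neg (suc n) _)
  where
  negate : ∀ i → binom n i * (- a i * b (n ∸ i)) ≡ - (binom n i * (a i * b (n ∸ i)))
  negate i = trans (cong (binom n i *_) (sym (ℚP.neg-distribˡ-* (a i) (b (n ∸ i)))))
                   (sym (ℚP.neg-distribʳ-* (binom n i) (a i * b (n ∸ i))))

-- Associativity: both sides are the sum of C(n; j, l, n-j-l) a_j b_l c_{n-j-l},
-- regrouped by sum-triangle and binomial-subset.
⊛-assoc : ∀ a b c → (a ⊛ b) ⊛ c ≐ a ⊛ (b ⊛ c)
⊛-assoc a b c n = begin
  sumBelow (suc n) (λ i → binom n i * ((a ⊛ b) i * c (n ∸ i)))
    ≡⟨ sum-ext (suc n) (λ i → trans (cong (binom n i *_) (sym (sum-*ʳ (suc i) _ (c (n ∸ i)))))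
                                    (sym (sum-*ˡ (suc i) (binom n i) _))) ⟩
  sumBelow (suc n) (λ i → sumBelow (suc i) (F i))
    ≡⟨ sum-triangle (suc n) F ⟩
  sumBelow (suc n) (λ j → sumBelow (suc n ∸ j) (λ l → F (j ℕ.+ l) j))
    ≡⟨ sum-cong (suc n) (λ j j≤n → regroup j (ℕP.≤-pred j≤n)) ⟩
  sumBelow (suc n) (λ j → binom n j * (a j * (b ⊛ c) (n ∸ j))) ∎
  where
  open ≡-Reasoning
  open ℚSolver.+-*-Solver
  F : ℕ → ℕ → ℚ
  F i j = binom n i * (binom i j * (a j * b (i ∸ j)) * c (n ∸ i))
  term : ∀ j l → j ≤ n → l ≤ n ∸ j →
         F (j ℕ.+ l) j ≡ (binom n j * a j) * (binom (n ∸ j) l * (b l * c (n ∸ j ∸ l)))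
  term j l j≤n l≤n∸j = begin
    binom n (j ℕ.+ l) * (binom (j ℕ.+ l) j * (a j * b (j ℕ.+ l ∸ j)) * c (n ∸ (j ℕ.+ l)))
      ≡⟨ cong₂ (λ x y → binom n (j ℕ.+ l) * (binom (j ℕ.+ l) j * (a j * b x) * c y))
               (ℕP.m+n∸m≡n j l) (sym (ℕP.∸-+-assoc n j l)) ⟩
    binom n (j ℕ.+ l) * (binom (j ℕ.+ l) j * (a j * b l) * c (n ∸ j ∸ l))
      ≡⟨ solve 5 (λ x y z w v → x :* (y :* (z :* w) :* v) := (x :* y) :* (z :* (w :* v))) refl
               (binom n (j ℕ.+ l)) (binom (j ℕ.+ l) j) (a j) (b l) (c (n ∸ j ∸ l)) ⟩
    (binom n (j ℕ.+ l) * binom (j ℕ.+ l) j) * (a j * (b l * c (n ∸ j ∸ l)))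
      ≡⟨ cong (_* (a j * (b l * c (n ∸ j ∸ l)))) subsets ⟩
    (binom n j * binom (n ∸ j) l) * (a j * (b l * c (n ∸ j ∸ l)))
      ≡⟨ solve 5 (λ x y z w v → (x :* y) :* (z :* (w :* v)) := (x :* z) :* (y :* (w :* v))) refl
               (binom n j) (binom (n ∸ j) l) (a j) (b l) (c (n ∸ j ∸ l)) ⟩
    (binom n j * a j) * (binom (n ∸ j) l * (b l * c (n ∸ j ∸ l))) ∎
    where
    j+l≤n : j ℕ.+ l ≤ n
    j+l≤n = subst (j ℕ.+ l ≤_) (ℕP.m+[n∸m]≡n j≤n) (ℕP.+-monoʳ-≤ j l≤n∸j)
    subsets : binom n (j ℕ.+ l) * binom (j ℕ.+ l) j ≡ binom n j * binom (n ∸ j) l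
    subsets = begin
      binom n (j ℕ.+ l) * binom (j ℕ.+ l) j               ≡⟨ ℕtoℚ-* (n C (j ℕ.+ l)) _ ⟨
      ℕtoℚ ((n C (j ℕ.+ l)) ℕ.* ((j ℕ.+ l) C j))          ≡⟨ cong ℕtoℚ (binomial-subset (ℕP.m≤m+n j l) j+l≤n) ⟩
      ℕtoℚ ((n C j) ℕ.* ((n ∸ j) C (j ℕ.+ l ∸ j)))        ≡⟨ cong (λ x → ℕtoℚ ((n C j) ℕ.* ((n ∸ j) C x))) (ℕP.m+n∸m≡n j l) ⟩
      ℕtoℚ ((n C j) ℕ.* ((n ∸ j) C l))                    ≡⟨ ℕtoℚ-* (n C j) ((n ∸ j) C l) ⟩
      binom n j * binom (n ∸ j) l                          ∎
  regroup : ∀ j → j ≤ n → sumBelow (suc n ∸ j) (λ l → F (j ℕ.+ l) j) ≡ binom n j * (a j * (b ⊛ c) (n ∸ j))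
  regroup j j≤n = begin
    sumBelow (suc n ∸ j) (λ l → F (j ℕ.+ l) j)
      ≡⟨ cong (λ d → sumBelow d (λ l → F (j ℕ.+ l) j)) (ℕP.+-∸-assoc 1 j≤n) ⟩
    sumBelow (suc (n ∸ j)) (λ l → F (j ℕ.+ l) j)
      ≡⟨ sum-cong (suc (n ∸ j)) (λ l l≤ → term j l j≤n (ℕP.≤-pred l≤)) ⟩
    sumBelow (suc (n ∸ j)) (λ l → (binom n j * a j) * (binom (n ∸ j) l * (b l * c (n ∸ j ∸ l))))
      ≡⟨ sum-*ˡ (suc (n ∸ j)) (binom n j * a j) _ ⟩
    (binom n j * a j) * (b ⊛ c) (n ∸ j)
      ≡⟨ ℚP.*-assoc (binom n j) (a j) _ ⟩
    binom n j * (a j * (b ⊛ c) (n ∸ j)) ∎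

SeqRing : AlmostCommutativeRing _ _
SeqRing = record
  { Carrier = Seq ; _≈_ = _≐_ ; _+_ = _⊕_ ; _*_ = _⊛_ ; -_ = neg ; 0# = 𝟘 ; 1# = 𝟙
  ; isAlmostCommutativeRing = record
    { isCommutativeSemiring = Biased.isCommutativeSemiringˡ (record
        { +-isCommutativeMonoid = Biased.isCommutativeMonoidˡ (record
            { isSemigroup = record
                { isMagma = record { isEquivalence = ≐-isEquivalence ; ∙-cong = ⊕-cong }
                ; assoc = λ a b c n → ℚP.+-assoc (a n) (b n) (c n) }
            ; identityˡ = λ a n → trans (cong (_+ a n) (𝟘≐0 n)) (ℚP.+-identityˡ (a n))
            ; comm = λ a b n → ℚP.+-comm (a n) (b n) })
        ; *-isCommutativeMonoid = Biased.isCommutativeMonoidˡ (record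
            { isSemigroup = record
                { isMagma = record { isEquivalence = ≐-isEquivalence ; ∙-cong = ⊛-cong }
                ; assoc = ⊛-assoc }
            ; identityˡ = λ a n → trans (ι-⊛ 1ℚ a n) (ℚP.*-identityˡ (a n))
            ; comm = ⊛-comm })
        ; distribʳ = λ c a b → ⊛-distribʳ a b c
        ; zeroˡ = λ a n → trans (ι-⊛ 0ℚ a n) (trans (ℚP.*-zeroˡ (a n)) (sym (𝟘≐0 n))) })
    ; -‿cong = neg-cong
    ; -‿*-distribˡ = neg-⊛
    ; -‿+-comm = λ a b n → sym (ℚP.neg-distrib-+ (a n) (b n)) } }
  where
  𝟘≐0 : 𝟘 ≐ λ _ → 0ℚ
  𝟘≐0 zero    = refl
  𝟘≐0 (suc n) = refl

ι-homomorphism : ℚP.+-*-rawRing -Raw-AlmostCommutative⟶ SeqRing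
ι-homomorphism = record
  { ⟦_⟧    = ι
  ; +-homo = λ { a b zero → refl ; a b (suc n) → sym (ℚP.+-identityˡ 0ℚ) }
  ; *-homo = λ a b n → trans (scale a b n) (sym (ι-⊛ a (ι b) n))
  ; -‿homo = λ { a zero → refl ; a (suc n) → refl }
  ; 0-homo = λ _ → refl
  ; 1-homo = λ _ → refl }
  where
  scale : ∀ a b n → ι (a * b) n ≡ a * ι b n
  scale a b zero    = refl
  scale a b (suc n) = sym (ℚP.*-zeroʳ a)

ι-equal? : ∀ a b → Maybe (ι a ≐ ι b)
ι-equal? a b with a ℚP.≟ b
... | yes refl = just (λ _ → refl)
... | no _     = nothing

module SeqSolver = RingSolver ℚP.+-*-rawRing SeqRing ι-homomorphism ι-equal?

-- The Euler operator θ = t·d/dt, (θ a)_n = n·a_n, and multiplication by t,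
-- (shift a)_{n+1} = (n+1)·a_n.  θ is a derivation of the EGF ring.
θ : Seq → Seq
θ a n = ℕtoℚ n * a n

shift : Seq → Seq
shift a zero    = 0ℚ
shift a (suc n) = ℕtoℚ (suc n) * a n

θ-cong : ∀ {a b} → a ≐ b → θ a ≐ θ b
θ-cong p n = cong (ℕtoℚ n *_) (p n)

shift-cong : ∀ {a b} → a ≐ b → shift a ≐ shift b
shift-cong p zero    = refl
shift-cong p (suc n) = cong (ℕtoℚ (suc n) *_) (p n)

θ-⊕ : ∀ a b → θ (a ⊕ b) ≐ θ a ⊕ θ b
θ-⊕ a b n = ℚP.*-distribˡ-+ (ℕtoℚ n) (a n) (b n)

θ-neg : ∀ a → θ (neg a) ≐ neg (θ a)
θ-neg a n = sym (ℚP.neg-distribʳ-* (ℕtoℚ n) (a n))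

θ-ι : ∀ c → θ (ι c) ≐ 𝟘
θ-ι c zero    = ℚP.*-zeroˡ c
θ-ι c (suc n) = ℚP.*-zeroʳ (ℕtoℚ (suc n))

-- The Leibniz rule, from n = i + (n - i) inside the convolution.
θ-Leibniz : ∀ a b → θ (a ⊛ b) ≐ θ a ⊛ b ⊕ a ⊛ θ b
θ-Leibniz a b n = begin
  ℕtoℚ n * sumBelow (suc n) (λ i → binom n i * (a i * b (n ∸ i)))
    ≡⟨ sum-*ˡ (suc n) (ℕtoℚ n) _ ⟨
  sumBelow (suc n) (λ i → ℕtoℚ n * (binom n i * (a i * b (n ∸ i))))
    ≡⟨ sum-cong (suc n) (λ i i≤n → split i (ℕP.≤-pred i≤n)) ⟩
  sumBelow (suc n) (λ i → binom n i * (θ a i * b (n ∸ i)) + binom n i * (a i * θ b (n ∸ i)))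
    ≡⟨ sum-+ (suc n) _ _ ⟩
  (θ a ⊛ b ⊕ a ⊛ θ b) n ∎
  where
  open ≡-Reasoning
  open ℚSolver.+-*-Solver
  split : ∀ i → i ≤ n → ℕtoℚ n * (binom n i * (a i * b (n ∸ i)))
                       ≡ binom n i * (θ a i * b (n ∸ i)) + binom n i * (a i * θ b (n ∸ i))
  split i i≤n = begin
    ℕtoℚ n * (binom n i * (a i * b (n ∸ i)))
      ≡⟨ cong (λ x → ℕtoℚ x * (binom n i * (a i * b (n ∸ i)))) (ℕP.m+[n∸m]≡n i≤n) ⟨
    ℕtoℚ (i ℕ.+ (n ∸ i)) * (binom n i * (a i * b (n ∸ i)))
      ≡⟨ cong (_* (binom n i * (a i * b (n ∸ i)))) (ℕtoℚ-+ i (n ∸ i)) ⟩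
    (ℕtoℚ i + ℕtoℚ (n ∸ i)) * (binom n i * (a i * b (n ∸ i)))
      ≡⟨ solve 5 (λ x y c u v → (x :+ y) :* (c :* (u :* v)) := c :* ((x :* u) :* v) :+ c :* (u :* (y :* v))) refl
               (ℕtoℚ i) (ℕtoℚ (n ∸ i)) (binom n i) (a i) (b (n ∸ i)) ⟩
    binom n i * (θ a i * b (n ∸ i)) + binom n i * (a i * θ b (n ∸ i)) ∎

-- Multiplication by t commutes with the product: a·(t b) = t (a b);
-- this is the absorption identity for binomial coefficients.
⊛-shift : ∀ a b → a ⊛ shift b ≐ shift (a ⊛ b)
⊛-shift a b zero = trans (ℚP.+-identityˡ _) (trans (cong (1ℚ *_) (ℚP.*-zeroʳ (a 0))) (ℚP.*-zeroʳ 1ℚ))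
⊛-shift a b (suc n) = begin
  sumBelow (suc n) (λ i → binom (suc n) i * (a i * shift b (suc n ∸ i)))
    + binom (suc n) (suc n) * (a (suc n) * shift b (suc n ∸ suc n))
    ≡⟨ cong₂ _+_ (sum-cong (suc n) (λ i i≤n → absorb i (ℕP.≤-pred i≤n))) lastVanishes ⟩
  sumBelow (suc n) (λ i → ℕtoℚ (suc n) * (binom n i * (a i * b (n ∸ i)))) + 0ℚ
    ≡⟨ ℚP.+-identityʳ _ ⟩
  sumBelow (suc n) (λ i → ℕtoℚ (suc n) * (binom n i * (a i * b (n ∸ i))))
    ≡⟨ sum-*ˡ (suc n) (ℕtoℚ (suc n)) _ ⟩
  ℕtoℚ (suc n) * (a ⊛ b) n ∎
  where
  open ≡-Reasoning
  open ℚSolver.+-*-Solver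
  lastVanishes : binom (suc n) (suc n) * (a (suc n) * shift b (suc n ∸ suc n)) ≡ 0ℚ
  lastVanishes = trans (cong (λ x → binom (suc n) (suc n) * (a (suc n) * shift b x)) (ℕP.n∸n≡0 n))
                 (trans (cong (binom (suc n) (suc n) *_) (ℚP.*-zeroʳ (a (suc n)))) (ℚP.*-zeroʳ (binom (suc n) (suc n))))
  absorb : ∀ i → i ≤ n → binom (suc n) i * (a i * shift b (suc n ∸ i))
                        ≡ ℕtoℚ (suc n) * (binom n i * (a i * b (n ∸ i)))
  absorb i i≤n = begin
    binom (suc n) i * (a i * shift b (suc n ∸ i))
      ≡⟨ cong (λ x → binom (suc n) i * (a i * shift b x)) 1+n∸i ⟩
    binom (suc n) i * (a i * (ℕtoℚ (suc (n ∸ i)) * b (n ∸ i)))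
      ≡⟨ solve 4 (λ c s u v → c :* (u :* (s :* v)) := (c :* s) :* (u :* v)) refl
               (binom (suc n) i) (ℕtoℚ (suc (n ∸ i))) (a i) (b (n ∸ i)) ⟩
    (binom (suc n) i * ℕtoℚ (suc (n ∸ i))) * (a i * b (n ∸ i))
      ≡⟨ cong (_* (a i * b (n ∸ i))) coefficient ⟩
    (ℕtoℚ (suc n) * binom n i) * (a i * b (n ∸ i))
      ≡⟨ ℚP.*-assoc (ℕtoℚ (suc n)) (binom n i) _ ⟩
    ℕtoℚ (suc n) * (binom n i * (a i * b (n ∸ i))) ∎
    where
    1+n∸i : suc n ∸ i ≡ suc (n ∸ i)
    1+n∸i = ℕP.+-∸-assoc 1 i≤n
    coefficient : binom (suc n) i * ℕtoℚ (suc (n ∸ i)) ≡ ℕtoℚ (suc n) * binom n i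
    coefficient = begin
      binom (suc n) i * ℕtoℚ (suc (n ∸ i))   ≡⟨ ℕtoℚ-* (suc n C i) (suc (n ∸ i)) ⟨
      ℕtoℚ ((suc n C i) ℕ.* suc (n ∸ i))     ≡⟨ cong (λ x → ℕtoℚ ((suc n C i) ℕ.* x)) 1+n∸i ⟨
      ℕtoℚ ((suc n C i) ℕ.* (suc n ∸ i))     ≡⟨ cong ℕtoℚ (binomial-absorption i≤n) ⟩
      ℕtoℚ (suc n ℕ.* (n C i))               ≡⟨ ℕtoℚ-* (suc n) (n C i) ⟩
      ℕtoℚ (suc n) * binom n i               ∎

-- Inverses of series.  invUpTo a n computes the first n+1 coefficients of the
-- inverse; they do not change when n grows, so egfInv a satisfies the
-- defining recursion and is a genuine inverse when a_0 = 1.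
module SeriesInverse (a : Seq) (a₀≡1 : a 0 ≡ 1ℚ) where
  open ≡-Reasoning

  if-≤ᵇ-yes : ∀ {i n} (x y : ℚ) → i ≤ n → (if i ℕ.≤ᵇ n then x else y) ≡ x
  if-≤ᵇ-yes {i} {n} x y i≤n with i ℕ.≤ᵇ n | ℕP.≤⇒≤ᵇ i≤n
  ... | true | _ = refl

  invUpTo-stable : ∀ n i → i ≤ n → invUpTo a n i ≡ egfInv a i
  invUpTo-stable zero    zero ℕ.z≤n = refl
  invUpTo-stable (suc n) i i≤1+n with ℕP.m≤n⇒m<n∨m≡n i≤1+n
  ... | inj₁ i≤n = trans (if-≤ᵇ-yes _ _ (ℕP.≤-pred i≤n)) (invUpTo-stable n i (ℕP.≤-pred i≤n))
  ... | inj₂ refl = refl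

  if-≤ᵇ-no : ∀ {n} (x y : ℚ) → (if suc n ℕ.≤ᵇ n then x else y) ≡ y
  if-≤ᵇ-no {n} x y with suc n ℕ.≤ᵇ n in eq
  ... | false = refl
  ... | true  = ⊥-elim (ℕP.n≮n n (ℕP.≤ᵇ⇒≤ (suc n) n (subst Bool.T (sym eq) tt)))

  egfInv-recursion : ∀ n → egfInv a (suc n) ≡ - sumBelow (suc n) (λ j → binom (suc n) j * (egfInv a j * a (suc n ∸ j)))
  egfInv-recursion n = trans (if-≤ᵇ-no {n} (invUpTo a n (suc n)) _) (cong -_ (sum-cong (suc n) (λ j j≤n →
    cong (λ x → binom (suc n) j * (x * a (suc n ∸ j))) (invUpTo-stable n j (ℕP.≤-pred j≤n)))))

  egfInv-inverse : egfInv a ⊛ a ≐ 𝟙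
  egfInv-inverse zero = trans (ℚP.+-identityˡ _) (trans (ℚP.*-identityˡ _) (trans (ℚP.*-identityˡ _) a₀≡1))
  egfInv-inverse (suc n) = begin
    S + binom (suc n) (suc n) * (egfInv a (suc n) * a (suc n ∸ suc n))
      ≡⟨ cong₂ (λ c i → S + ℕtoℚ c * (egfInv a (suc n) * a i)) (nCn≡1 (suc n)) (ℕP.n∸n≡0 n) ⟩
    S + 1ℚ * (egfInv a (suc n) * a 0)
      ≡⟨ cong (λ x → S + 1ℚ * (egfInv a (suc n) * x)) a₀≡1 ⟩
    S + 1ℚ * (egfInv a (suc n) * 1ℚ)
      ≡⟨ cong (λ x → S + x) (trans (ℚP.*-identityˡ _) (ℚP.*-identityʳ _)) ⟩
    S + egfInv a (suc n)
      ≡⟨ cong (λ x → S + x) (egfInv-recursion n) ⟩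
    S + - S
      ≡⟨ ℚP.+-inverseʳ S ⟩
    0ℚ ∎
    where
    S : ℚ
    S = sumBelow (suc n) (λ j → binom (suc n) j * (egfInv a j * a (suc n ∸ j)))

B⊛expm1Overt : B ⊛ expm1Overt ≐ 𝟙
B⊛expm1Overt = SeriesInverse.egfInv-inverse expm1Overt refl

κ : ℕ → Seq
κ k = ι (ℕtoℚ k)

κ-suc : ∀ k → κ (suc k) ≐ 𝟙 ⊕ κ k
κ-suc k zero    = ℕtoℚ-suc k
κ-suc k (suc n) = refl

⊛-congˡ : ∀ a {b b′} → b ≐ b′ → a ⊛ b ≐ a ⊛ b′
⊛-congˡ a = ⊛-cong {a} {a} ≐-refl

⊛-congʳ : ∀ b {a a′} → a ≐ a′ → a ⊛ b ≐ a′ ⊛ b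
⊛-congʳ b p = ⊛-cong {b = b} {b} p ≐-refl

⊕-congˡ : ∀ a {b b′} → b ≐ b′ → a ⊕ b ≐ a ⊕ b′
⊕-congˡ a = ⊕-cong {a} {a} ≐-refl

⊕-congʳ : ∀ b {a a′} → a ≐ a′ → a ⊕ b ≐ a′ ⊕ b
⊕-congʳ b p = ⊕-cong {b = b} {b} p ≐-refl

module InversePair (g f : Seq) (g⊛f : g ⊛ f ≐ 𝟙) where
  open SeqSolver
  open SetoidReasoning SeqSetoid

  h : Seq
  h = g ⊛ θ f

  G P : ℕ → Seq
  G = egfPow g
  P = egfPow f

  pow-inverse : ∀ k → G k ⊛ P k ≐ 𝟙
  pow-inverse zero = begin
    egfOne ⊛ egfOne ≈⟨ ⊛-cong egfOne≐𝟙 egfOne≐𝟙 ⟩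
    𝟙 ⊛ 𝟙           ≈⟨ solve 0 (con 1ℚ :* con 1ℚ := con 1ℚ) ≐-refl ⟩
    𝟙               ∎
  pow-inverse (suc k) = begin
    (g ⊛ G k) ⊛ (f ⊛ P k)
      ≈⟨ solve 4 (λ a b c d → (a :* b) :* (c :* d) := (a :* c) :* (b :* d)) ≐-refl g (G k) f (P k) ⟩
    (g ⊛ f) ⊛ (G k ⊛ P k) ≈⟨ ⊛-cong g⊛f (pow-inverse k) ⟩
    𝟙 ⊛ 𝟙                 ≈⟨ solve 0 (con 1ℚ :* con 1ℚ := con 1ℚ) ≐-refl ⟩
    𝟙                     ∎

  pow-θ : ∀ k → G k ⊛ θ (P k) ≐ κ k ⊛ h
  pow-θ zero = begin
    egfOne ⊛ θ egfOne ≈⟨ ⊛-cong egfOne≐𝟙 (θ-cong egfOne≐𝟙) ⟩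
    𝟙 ⊛ θ 𝟙           ≈⟨ ⊛-congˡ 𝟙 (θ-ι 1ℚ) ⟩
    𝟙 ⊛ 𝟘             ≈⟨ solve 1 (λ a → con 1ℚ :* con 0ℚ := con 0ℚ :* a) ≐-refl h ⟩
    κ 0 ⊛ h           ∎
  pow-θ (suc k) = begin
    (g ⊛ G k) ⊛ θ (f ⊛ P k)
      ≈⟨ ⊛-congˡ (g ⊛ G k) (θ-Leibniz f (P k)) ⟩
    (g ⊛ G k) ⊛ (θ f ⊛ P k ⊕ f ⊛ θ (P k))
      ≈⟨ solve 6 (λ a b c d u v → (a :* b) :* (c :* d :+ u :* v) := (a :* c) :* (b :* d) :+ (a :* u) :* (b :* v))
               ≐-refl g (G k) (θ f) (P k) f (θ (P k)) ⟩
    h ⊛ (G k ⊛ P k) ⊕ (g ⊛ f) ⊛ (G k ⊛ θ (P k))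
      ≈⟨ ⊕-cong (⊛-congˡ h (pow-inverse k)) (⊛-cong g⊛f (pow-θ k)) ⟩
    h ⊛ 𝟙 ⊕ 𝟙 ⊛ (κ k ⊛ h)
      ≈⟨ solve 2 (λ a c → a :* con 1ℚ :+ con 1ℚ :* (c :* a) := (con 1ℚ :+ c) :* a) ≐-refl h (κ k) ⟩
    (𝟙 ⊕ κ k) ⊛ h
      ≈⟨ ⊛-congʳ h (κ-suc k) ⟨
    κ (suc k) ⊛ h ∎

  θθ-Leibniz : ∀ a b → θ (θ (a ⊛ b)) ≐ θ (θ a) ⊛ b ⊕ θ a ⊛ θ b ⊕ θ a ⊛ θ b ⊕ a ⊛ θ (θ b)
  θθ-Leibniz a b = begin
    θ (θ (a ⊛ b))             ≈⟨ θ-cong (θ-Leibniz a b) ⟩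
    θ (θ a ⊛ b ⊕ a ⊛ θ b)     ≈⟨ θ-⊕ (θ a ⊛ b) (a ⊛ θ b) ⟩
    θ (θ a ⊛ b) ⊕ θ (a ⊛ θ b) ≈⟨ ⊕-cong (θ-Leibniz (θ a) b) (θ-Leibniz a (θ b)) ⟩
    (θ (θ a) ⊛ b ⊕ θ a ⊛ θ b) ⊕ (θ a ⊛ θ b ⊕ a ⊛ θ (θ b))
      ≈⟨ solve 4 (λ x y u v → (x :+ y) :+ (u :+ v) := x :+ y :+ u :+ v) ≐-refl
               (θ (θ a) ⊛ b) (θ a ⊛ θ b) (θ a ⊛ θ b) (a ⊛ θ (θ b)) ⟩
    θ (θ a) ⊛ b ⊕ θ a ⊛ θ b ⊕ θ a ⊛ θ b ⊕ a ⊛ θ (θ b) ∎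

  q : Seq
  q = g ⊛ θ (θ f)

  pow-θθ : ∀ k → G k ⊛ θ (θ (P k)) ≐ κ k ⊛ (q ⊕ (κ k ⊕ neg 𝟙) ⊛ (h ⊛ h))
  pow-θθ zero = begin
    egfOne ⊛ θ (θ egfOne) ≈⟨ ⊛-cong egfOne≐𝟙 (θ-cong (θ-cong egfOne≐𝟙)) ⟩
    𝟙 ⊛ θ (θ 𝟙)           ≈⟨ ⊛-congˡ 𝟙 (θ-cong (θ-ι 1ℚ)) ⟩
    𝟙 ⊛ θ 𝟘               ≈⟨ ⊛-congˡ 𝟙 (θ-ι 0ℚ) ⟩
    𝟙 ⊛ 𝟘                 ≈⟨ solve 2 (λ a b → con 1ℚ :* con 0ℚ := con 0ℚ :* (a :+ (con 0ℚ :+ :- con 1ℚ) :* b))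
                                    ≐-refl q (h ⊛ h) ⟩
    κ 0 ⊛ (q ⊕ (κ 0 ⊕ neg 𝟙) ⊛ (h ⊛ h)) ∎
  pow-θθ (suc k) = begin
    (g ⊛ G k) ⊛ θ (θ (f ⊛ P k))
      ≈⟨ ⊛-congˡ (g ⊛ G k) (θθ-Leibniz f (P k)) ⟩
    (g ⊛ G k) ⊛ (θ (θ f) ⊛ P k ⊕ θ f ⊛ θ (P k) ⊕ θ f ⊛ θ (P k) ⊕ f ⊛ θ (θ (P k)))
      ≈⟨ solve 8 (λ a b c d u v w z → (a :* b) :* (c :* d :+ u :* v :+ u :* v :+ w :* z)
                    := (a :* c) :* (b :* d) :+ (a :* u) :* (b :* v) :+ (a :* u) :* (b :* v) :+ (a :* w) :* (b :* z))
               ≐-refl g (G k) (θ (θ f)) (P k) (θ f) (θ (P k)) f (θ (θ (P k))) ⟩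
    q ⊛ (G k ⊛ P k) ⊕ h ⊛ (G k ⊛ θ (P k)) ⊕ h ⊛ (G k ⊛ θ (P k)) ⊕ (g ⊛ f) ⊛ (G k ⊛ θ (θ (P k)))
      ≈⟨ ⊕-cong (⊕-cong (⊕-cong (⊛-congˡ q (pow-inverse k)) (⊛-congˡ h (pow-θ k))) (⊛-congˡ h (pow-θ k)))
                (⊛-cong g⊛f (pow-θθ k)) ⟩
    q ⊛ 𝟙 ⊕ h ⊛ (κ k ⊛ h) ⊕ h ⊛ (κ k ⊛ h) ⊕ 𝟙 ⊛ (κ k ⊛ (q ⊕ (κ k ⊕ neg 𝟙) ⊛ (h ⊛ h)))
      ≈⟨ solve 3 (λ a b c → a :* con 1ℚ :+ b :* (c :* b) :+ b :* (c :* b) :+ con 1ℚ :* (c :* (a :+ (c :+ :- con 1ℚ) :* (b :* b)))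
                   := (con 1ℚ :+ c) :* (a :+ ((con 1ℚ :+ c) :+ :- con 1ℚ) :* (b :* b))) ≐-refl q h (κ k) ⟩
    (𝟙 ⊕ κ k) ⊛ (q ⊕ ((𝟙 ⊕ κ k) ⊕ neg 𝟙) ⊛ (h ⊛ h))
      ≈⟨ ⊛-cong (κ-suc k) (⊕-congˡ q (⊛-congʳ (h ⊛ h) (⊕-congʳ (neg 𝟙) (κ-suc k)))) ⟨
    κ (suc k) ⊛ (q ⊕ (κ (suc k) ⊕ neg 𝟙) ⊛ (h ⊛ h)) ∎

  -- Differentiating g·f = 1 gives θg·f + g·θf = 0, i.e. g·h = -θg.
  g⊛h : g ⊛ h ≐ neg (θ g)
  g⊛h = begin
    g ⊛ (g ⊛ θ f)
      ≈⟨ solve 4 (λ a d b t → a :* (a :* t) := a :* (d :* b :+ a :* t) :+ :- (d :* (a :* b)))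
               ≐-refl g (θ g) f (θ f) ⟩
    g ⊛ (θ g ⊛ f ⊕ g ⊛ θ f) ⊕ neg (θ g ⊛ (g ⊛ f))
      ≈⟨ ⊕-congʳ (neg (θ g ⊛ (g ⊛ f))) (⊛-congˡ g (θ-Leibniz g f)) ⟨
    g ⊛ θ (g ⊛ f) ⊕ neg (θ g ⊛ (g ⊛ f))
      ≈⟨ ⊕-cong (⊛-congˡ g (θ-cong g⊛f)) (neg-cong (⊛-congˡ (θ g) g⊛f)) ⟩
    g ⊛ θ 𝟙 ⊕ neg (θ g ⊛ 𝟙)
      ≈⟨ ⊕-congʳ (neg (θ g ⊛ 𝟙)) (⊛-congˡ g (θ-ι 1ℚ)) ⟩
    g ⊛ 𝟘 ⊕ neg (θ g ⊛ 𝟙)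
      ≈⟨ solve 2 (λ a d → a :* con 0ℚ :+ :- (d :* con 1ℚ) := :- d) ≐-refl g (θ g) ⟩
    neg (θ g) ∎

  -- The second-order sum of the theorem corresponds to θ² - θ = θ(θ - 1).
  pow-θ[θ-1] : ∀ k → G k ⊛ (θ (θ (P k)) ⊕ neg (θ (P k))) ≐ κ k ⊛ (q ⊕ neg h ⊕ (κ k ⊕ neg 𝟙) ⊛ (h ⊛ h))
  pow-θ[θ-1] k = begin
    G k ⊛ (θ (θ (P k)) ⊕ neg (θ (P k)))
      ≈⟨ solve 3 (λ a b c → a :* (b :+ :- c) := a :* b :+ :- (a :* c)) ≐-refl (G k) (θ (θ (P k))) (θ (P k)) ⟩
    G k ⊛ θ (θ (P k)) ⊕ neg (G k ⊛ θ (P k))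
      ≈⟨ ⊕-cong (pow-θθ k) (neg-cong (pow-θ k)) ⟩
    κ k ⊛ (q ⊕ (κ k ⊕ neg 𝟙) ⊛ (h ⊛ h)) ⊕ neg (κ k ⊛ h)
      ≈⟨ solve 4 (λ c a b s → c :* (a :+ (c :+ :- con 1ℚ) :* s) :+ :- (c :* b) := c :* (a :+ :- b :+ (c :+ :- con 1ℚ) :* s))
               ≐-refl (κ k) q h (h ⊛ h) ⟩
    κ k ⊛ (q ⊕ neg h ⊕ (κ k ⊕ neg 𝟙) ⊛ (h ⊛ h)) ∎

open InversePair B expm1Overt B⊛expm1Overt

exp X : Seq
exp _ = 1ℚ
X = shift 𝟙

-- θ((e^t-1)/t) = e^t - (e^t-1)/t, coefficientwise n/(n+1) = 1 - 1/(n+1).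
θ-expm1Overt : θ expm1Overt ≐ exp ⊕ neg expm1Overt
θ-expm1Overt n = begin
  ℕtoℚ n * expm1Overt n
    ≡⟨ solve 2 (λ x y → x :* y := (con 1ℚ :+ x) :* y :+ :- y) refl (ℕtoℚ n) (expm1Overt n) ⟩
  (1ℚ + ℕtoℚ n) * expm1Overt n + - expm1Overt n
    ≡⟨ cong (λ z → z * expm1Overt n + - expm1Overt n) (ℕtoℚ-suc n) ⟨
  ℕtoℚ (suc n) * expm1Overt n + - expm1Overt n
    ≡⟨ cong (λ z → z + - expm1Overt n) (expm1Overt-inverse n) ⟩
  1ℚ + - expm1Overt n ∎
  where
  open ≡-Reasoning
  open ℚSolver.+-*-Solver

exp-split : exp ≐ 𝟙 ⊕ shift expm1Overt
exp-split zero    = sym (ℚP.+-identityʳ 1ℚ)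
exp-split (suc n) = trans (sym (expm1Overt-inverse n)) (sym (ℚP.+-identityˡ _))

θ-exp : θ exp ≐ shift exp
θ-exp zero    = refl
θ-exp (suc n) = refl

module _ where
  open SeqSolver
  open SetoidReasoning SeqSetoid

  ⊛-X : ∀ a → a ⊛ X ≐ shift a
  ⊛-X a = begin
    a ⊛ shift 𝟙   ≈⟨ ⊛-shift a 𝟙 ⟩
    shift (a ⊛ 𝟙) ≈⟨ shift-cong (solve 1 (λ x → x :* con 1ℚ := x) ≐-refl a) ⟩
    shift a       ∎

  B⊛exp : B ⊛ exp ≐ B ⊕ X
  B⊛exp = begin
    B ⊛ exp                       ≈⟨ ⊛-congˡ B exp-split ⟩
    B ⊛ (𝟙 ⊕ shift expm1Overt)    ≈⟨ solve 2 (λ a b → a :* (con 1ℚ :+ b) := a :+ a :* b) ≐-refl B (shift expm1Overt) ⟩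
    B ⊕ B ⊛ shift expm1Overt      ≈⟨ ⊕-congˡ B (⊛-shift B expm1Overt) ⟩
    B ⊕ shift (B ⊛ expm1Overt)    ≈⟨ ⊕-congˡ B (shift-cong B⊛expm1Overt) ⟩
    B ⊕ X                         ∎

  h≐ : h ≐ B ⊕ X ⊕ neg 𝟙
  h≐ = begin
    B ⊛ θ expm1Overt                  ≈⟨ ⊛-congˡ B θ-expm1Overt ⟩
    B ⊛ (exp ⊕ neg expm1Overt)        ≈⟨ solve 3 (λ a b c → a :* (b :+ :- c) := a :* b :+ :- (a :* c)) ≐-refl B exp expm1Overt ⟩
    B ⊛ exp ⊕ neg (B ⊛ expm1Overt)    ≈⟨ ⊕-cong B⊛exp (neg-cong B⊛expm1Overt) ⟩
    B ⊕ X ⊕ neg 𝟙                     ∎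

  q≐ : q ≐ shift (B ⊕ X) ⊕ neg h
  q≐ = begin
    B ⊛ θ (θ expm1Overt)                 ≈⟨ ⊛-congˡ B (θ-cong θ-expm1Overt) ⟩
    B ⊛ θ (exp ⊕ neg expm1Overt)         ≈⟨ ⊛-congˡ B (θ-⊕ exp (neg expm1Overt)) ⟩
    B ⊛ (θ exp ⊕ θ (neg expm1Overt))     ≈⟨ ⊛-congˡ B (⊕-cong θ-exp (θ-neg expm1Overt)) ⟩
    B ⊛ (shift exp ⊕ neg h′)             ≈⟨ solve 3 (λ a b c → a :* (b :+ :- c) := a :* b :+ :- (a :* c)) ≐-refl B (shift exp) h′ ⟩
    B ⊛ shift exp ⊕ neg h                ≈⟨ ⊕-congʳ (neg h) (⊛-shift B exp) ⟩
    shift (B ⊛ exp) ⊕ neg h              ≈⟨ ⊕-congʳ (neg h) (shift-cong B⊛exp) ⟩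
    shift (B ⊕ X) ⊕ neg h                ∎
    where
    h′ : Seq
    h′ = θ expm1Overt

  -- h² = g·h + t·h - h = -θB + t·h - h.
  h²≐ : h ⊛ h ≐ neg (θ B) ⊕ shift h ⊕ neg h
  h²≐ = begin
    h ⊛ h                        ≈⟨ ⊛-congˡ h h≐ ⟩
    h ⊛ (B ⊕ X ⊕ neg 𝟙)          ≈⟨ solve 3 (λ a b x → a :* (b :+ x :+ :- con 1ℚ) := b :* a :+ a :* x :+ :- a) ≐-refl h B X ⟩
    B ⊛ h ⊕ h ⊛ X ⊕ neg h        ≈⟨ ⊕-congʳ (neg h) (⊕-cong g⊛h (⊛-X h)) ⟩
    neg (θ B) ⊕ shift h ⊕ neg h  ∎

module _ where
  open ≡-Reasoning

  X-high : ∀ n → X (suc (suc n)) ≡ 0ℚ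
  X-high n = ℚP.*-zeroʳ (ℕtoℚ (suc (suc n)))

  h-one : h 1 ≡ - B 1
  h-one = refl

  -- For m ≥ 2 (resp. m ≥ 3) the corrections from t and 1 disappear:
  -- h_m = B_m, q_m = m B_{m-1} - B_m, (h²)_m = -m B_m + m B_{m-1} - B_m.
  h-high : ∀ n → h (suc (suc n)) ≡ B (suc (suc n))
  h-high n = begin
    h m                    ≡⟨ h≐ m ⟩
    B m + X m + - 0ℚ       ≡⟨ cong (λ x → B m + x + - 0ℚ) (X-high n) ⟩
    B m + 0ℚ + 0ℚ          ≡⟨ trans (ℚP.+-identityʳ _) (ℚP.+-identityʳ (B m)) ⟩
    B m                    ∎
    where
    m : ℕ
    m = suc (suc n)

  q-high : ∀ n → q (suc (suc (suc n))) ≡ ℕtoℚ (suc (suc (suc n))) * B (suc (suc n)) + - B (suc (suc (suc n)))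
  q-high n = begin
    q (suc m)                                        ≡⟨ q≐ (suc m) ⟩
    ℕtoℚ (suc m) * (B m + X m) + - h (suc m)         ≡⟨ cong₂ (λ x y → ℕtoℚ (suc m) * (B m + x) + - y) (X-high n) (h-high (suc n)) ⟩
    ℕtoℚ (suc m) * (B m + 0ℚ) + - B (suc m)          ≡⟨ cong (λ x → ℕtoℚ (suc m) * x + - B (suc m)) (ℚP.+-identityʳ (B m)) ⟩
    ℕtoℚ (suc m) * B m + - B (suc m)                 ∎
    where
    m : ℕ
    m = suc (suc n)

  h²-high : ∀ n → (h ⊛ h) (suc (suc (suc n)))
              ≡ - (ℕtoℚ (suc (suc (suc n))) * B (suc (suc (suc n))))
                + ℕtoℚ (suc (suc (suc n))) * B (suc (suc n)) + - B (suc (suc (suc n)))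
  h²-high n = trans (h²≐ (suc m)) (cong₂ (λ x y → - (ℕtoℚ (suc m) * B (suc m)) + ℕtoℚ (suc m) * x + - y)
                                         (h-high n) (h-high (suc n)))
    where
    m : ℕ
    m = suc (suc n)

-- The sums of the theorem are coefficients of a·θb and a·(θ²b - θb): the
-- weight (m-q) is the factor produced by θ, and the terms dropped from the
-- sums are exactly those whose weight vanishes.
module _ where
  open ≡-Reasoning
  open ℚSolver.+-*-Solver

  weighted-sum-θ : ∀ (a b : Seq) m →
    sumBelow m (λ i → binom m i * (ℕtoℚ (m ∸ i) * (a i * b (m ∸ i)))) ≡ (a ⊛ θ b) m
  weighted-sum-θ a b m = sym (begin
    sumBelow m term′ + term′ m ≡⟨ cong₂ _+_ (sum-ext m reorder) lastVanishes ⟩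
    sumBelow m term + 0ℚ       ≡⟨ ℚP.+-identityʳ _ ⟩
    sumBelow m term            ∎)
    where
    term term′ : ℕ → ℚ
    term  i = binom m i * (ℕtoℚ (m ∸ i) * (a i * b (m ∸ i)))
    term′ i = binom m i * (a i * (ℕtoℚ (m ∸ i) * b (m ∸ i)))
    reorder : ∀ i → term′ i ≡ term i
    reorder i = solve 4 (λ c x w y → c :* (x :* (w :* y)) := c :* (w :* (x :* y))) refl
                        (binom m i) (a i) (ℕtoℚ (m ∸ i)) (b (m ∸ i))
    lastVanishes : term′ m ≡ 0ℚ
    lastVanishes = begin
      binom m m * (a m * (ℕtoℚ (m ∸ m) * b (m ∸ m))) ≡⟨ cong (λ x → binom m m * (a m * (ℕtoℚ x * b x))) (ℕP.n∸n≡0 m) ⟩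
      binom m m * (a m * (0ℚ * b 0))                 ≡⟨ solve 3 (λ c x y → c :* (x :* (con 0ℚ :* y)) := con 0ℚ) refl (binom m m) (a m) (b 0) ⟩
      0ℚ                                              ∎

  falling-square : ∀ j (p : ℚ) → ℕtoℚ j * (ℕtoℚ (j ∸ 1) * p) ≡ ℕtoℚ j * (ℕtoℚ j * p) + - (ℕtoℚ j * p)
  falling-square zero    p = solve 1 (λ p → con 0ℚ :* (con 0ℚ :* p) := con 0ℚ :* (con 0ℚ :* p) :+ :- (con 0ℚ :* p)) refl p
  falling-square (suc j) p = begin
    ℕtoℚ (suc j) * (ℕtoℚ j * p)
      ≡⟨ cong (λ x → x * (ℕtoℚ j * p)) (ℕtoℚ-suc j) ⟩
    (1ℚ + ℕtoℚ j) * (ℕtoℚ j * p)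
      ≡⟨ solve 2 (λ x p → (con 1ℚ :+ x) :* (x :* p) := (con 1ℚ :+ x) :* ((con 1ℚ :+ x) :* p) :+ :- ((con 1ℚ :+ x) :* p)) refl (ℕtoℚ j) p ⟩
    (1ℚ + ℕtoℚ j) * ((1ℚ + ℕtoℚ j) * p) + - ((1ℚ + ℕtoℚ j) * p)
      ≡⟨ cong (λ x → x * (x * p) + - (x * p)) (ℕtoℚ-suc j) ⟨
    ℕtoℚ (suc j) * (ℕtoℚ (suc j) * p) + - (ℕtoℚ (suc j) * p) ∎

  weighted-sum-θ[θ-1] : ∀ (a b : Seq) n →
    sumBelow (suc n) (λ i → binom (suc (suc n)) i * (ℕtoℚ (suc (suc n) ∸ i) * (ℕtoℚ (suc (suc n) ∸ i ∸ 1) * (a i * b (suc (suc n) ∸ i)))))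
      ≡ (a ⊛ (θ (θ b) ⊕ neg (θ b))) (suc (suc n))
  weighted-sum-θ[θ-1] a b n = sym (begin
    sumBelow (suc n) term′ + term′ (suc n) + term′ m
      ≡⟨ cong₂ _+_ (cong₂ _+_ (sum-ext (suc n) reorder) (trans (reorder (suc n)) (vanishes (suc n) ℕP.≤-refl)))
                   (trans (reorder m) (vanishes m (ℕP.n≤1+n m))) ⟩
    sumBelow (suc n) term + 0ℚ + 0ℚ
      ≡⟨ trans (ℚP.+-identityʳ _) (ℚP.+-identityʳ _) ⟩
    sumBelow (suc n) term ∎)
    where
    m : ℕ
    m = suc (suc n)
    term term′ : ℕ → ℚ
    term  i = binom m i * (ℕtoℚ (m ∸ i) * (ℕtoℚ (m ∸ i ∸ 1) * (a i * b (m ∸ i))))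
    term′ i = binom m i * (a i * (ℕtoℚ (m ∸ i) * (ℕtoℚ (m ∸ i) * b (m ∸ i)) + - (ℕtoℚ (m ∸ i) * b (m ∸ i))))
    reorder : ∀ i → term′ i ≡ term i
    reorder i = begin
      binom m i * (a i * (ℕtoℚ j * (ℕtoℚ j * b j) + - (ℕtoℚ j * b j)))
        ≡⟨ cong (λ x → binom m i * (a i * x)) (falling-square j (b j)) ⟨
      binom m i * (a i * (ℕtoℚ j * (ℕtoℚ (j ∸ 1) * b j)))
        ≡⟨ solve 5 (λ c x y z p → c :* (x :* (y :* (z :* p))) := c :* (y :* (z :* (x :* p)))) refl
                 (binom m i) (a i) (ℕtoℚ j) (ℕtoℚ (j ∸ 1)) (b j) ⟩
      term i ∎
      where
      j : ℕ
      j = m ∸ i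
    vanishes : ∀ i → m ≤ suc i → term i ≡ 0ℚ
    vanishes i m≤1+i = begin
      term i
        ≡⟨ cong (λ x → binom m i * (ℕtoℚ (m ∸ i) * (ℕtoℚ x * (a i * b (m ∸ i)))))
                (trans (ℕP.∸-+-assoc m i 1) (ℕP.m≤n⇒m∸n≡0 (subst (m ≤_) (ℕP.+-comm 1 i) m≤1+i))) ⟩
      binom m i * (ℕtoℚ (m ∸ i) * (0ℚ * (a i * b (m ∸ i))))
        ≡⟨ solve 3 (λ c w p → c :* (w :* (con 0ℚ :* p)) := con 0ℚ) refl (binom m i) (ℕtoℚ (m ∸ i)) (a i * b (m ∸ i)) ⟩
      0ℚ ∎

firstSum secondSum : ℕ → ℕ → ℚ
firstSum k m =
  sumBelow m (λ q → ℕtoℚ (m C q) * (ℕtoℚ (m ∸ q) * (Bord (+ k) q * Bord (ℤ.- (+ k)) (m ∸ q))))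
secondSum k m =
  sumBelow (m ∸ 1) (λ q → ℕtoℚ (m C q) * (ℕtoℚ (m ∸ q) * (ℕtoℚ (m ∸ q ∸ 1) * (Bord (+ k) q * Bord (ℤ.- (+ k)) (m ∸ q)))))

Bord-negative : ∀ k → Bord (ℤ.- (+ k)) ≡ P k
Bord-negative zero    = refl
Bord-negative (suc k) = refl

module _ where
  open ≡-Reasoning
  open ℚSolver.+-*-Solver

  firstSum≡ : ∀ k m → firstSum k m ≡ ℕtoℚ k * h m
  firstSum≡ k m = begin
    firstSum k m
      ≡⟨ cong (λ Q → sumBelow m (λ i → binom m i * (ℕtoℚ (m ∸ i) * (G k i * Q (m ∸ i))))) (Bord-negative k) ⟩
    sumBelow m (λ i → binom m i * (ℕtoℚ (m ∸ i) * (G k i * P k (m ∸ i))))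
      ≡⟨ weighted-sum-θ (G k) (P k) m ⟩
    (G k ⊛ θ (P k)) m ≡⟨ pow-θ k m ⟩
    (κ k ⊛ h) m       ≡⟨ ι-⊛ (ℕtoℚ k) h m ⟩
    ℕtoℚ k * h m      ∎

  secondSum≡ : ∀ k n → let m = suc (suc n) in
    secondSum k m ≡ ℕtoℚ k * (q m + - h m + (ℕtoℚ k + - 1ℚ) * (h ⊛ h) m)
  secondSum≡ k n = begin
    secondSum k m
      ≡⟨ cong (λ Q → sumBelow (suc n) (λ i → binom m i * (ℕtoℚ (m ∸ i) * (ℕtoℚ (m ∸ i ∸ 1) * (G k i * Q (m ∸ i))))))
              (Bord-negative k) ⟩
    sumBelow (suc n) (λ i → binom m i * (ℕtoℚ (m ∸ i) * (ℕtoℚ (m ∸ i ∸ 1) * (G k i * P k (m ∸ i)))))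
      ≡⟨ weighted-sum-θ[θ-1] (G k) (P k) n ⟩
    (G k ⊛ (θ (θ (P k)) ⊕ neg (θ (P k)))) m
      ≡⟨ pow-θ[θ-1] k m ⟩
    (κ k ⊛ (q ⊕ neg h ⊕ (κ k ⊕ neg 𝟙) ⊛ (h ⊛ h))) m
      ≡⟨ ι-⊛ (ℕtoℚ k) (q ⊕ neg h ⊕ (κ k ⊕ neg 𝟙) ⊛ (h ⊛ h)) m ⟩
    ℕtoℚ k * (q m + - h m + ((κ k ⊕ neg 𝟙) ⊛ (h ⊛ h)) m)
      ≡⟨ cong (λ x → ℕtoℚ k * (q m + - h m + x)) (trans (⊛-congʳ (h ⊛ h) κ-1 m) (ι-⊛ _ (h ⊛ h) m)) ⟩
    ℕtoℚ k * (q m + - h m + (ℕtoℚ k + - 1ℚ) * (h ⊛ h) m) ∎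
    where
    m : ℕ
    m = suc (suc n)
    κ-1 : κ k ⊕ neg 𝟙 ≐ ι (ℕtoℚ k + - 1ℚ)
    κ-1 zero    = refl
    κ-1 (suc i) = refl

  firstSum-one : ∀ k → firstSum k 1 ≡ - (ℕtoℚ k * B 1)
  firstSum-one k = trans (firstSum≡ k 1) (trans (cong (ℕtoℚ k *_) h-one) (sym (ℚP.neg-distribʳ-* (ℕtoℚ k) (B 1))))

  firstSum-high : ∀ k n → firstSum k (suc (suc n)) ≡ ℕtoℚ k * B (suc (suc n))
  firstSum-high k n = trans (firstSum≡ k (suc (suc n))) (cong (ℕtoℚ k *_) (h-high n))

  secondSum-two : ∀ k →
    secondSum k 2 ≡ (- (ℕtoℚ k * (ℕtoℚ (3 ℕ.* k) ℚ.- 1ℚ) * B 2)) ℚ.- ℕtoℚ (2 ℕ.* k ℕ.* k) * B 1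
  secondSum-two k = begin
    secondSum k 2
      ≡⟨ secondSum≡ k 0 ⟩
    K * (q 2 + - h 2 + (K + - 1ℚ) * (h ⊛ h) 2)
      ≡⟨ solve 1 (λ x → x :* (con (q 2) :+ :- con (h 2) :+ (x :+ :- con 1ℚ) :* con ((h ⊛ h) 2))
                     := :- (x :* (con (ℕtoℚ 3) :* x :+ :- con 1ℚ) :* con (B 2)) :+ :- ((con (ℕtoℚ 2) :* x) :* x :* con (B 1)))
               refl K ⟩
    (- (K * (ℕtoℚ 3 * K ℚ.- 1ℚ) * B 2)) ℚ.- (ℕtoℚ 2 * K) * K * B 1
      ≡⟨ cong₂ (λ a b → (- (K * (a ℚ.- 1ℚ) * B 2)) ℚ.- b * B 1)
               (sym (ℕtoℚ-* 3 k)) (sym (trans (ℕtoℚ-* (2 ℕ.* k) k) (cong (_* K) (ℕtoℚ-* 2 k)))) ⟩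
    (- (K * (ℕtoℚ (3 ℕ.* k) ℚ.- 1ℚ) * B 2)) ℚ.- ℕtoℚ (2 ℕ.* k ℕ.* k) * B 1 ∎
    where
    K : ℚ
    K = ℕtoℚ k

  secondSum-high : ∀ k n → let m = suc (suc (suc n)) in
    secondSum k m ≡ (- (ℕtoℚ k * (ℕtoℚ ((m ℕ.+ 1) ℕ.* k) ℚ.- ℕtoℚ m ℚ.+ 1ℚ) * B m)) ℚ.+ ℕtoℚ (m ℕ.* k ℕ.* k) * B (m ∸ 1)
  secondSum-high k n = begin
    secondSum k m
      ≡⟨ secondSum≡ k (suc n) ⟩
    K * (q m + - h m + (K + - 1ℚ) * (h ⊛ h) m)
      ≡⟨ cong₃ (λ x y z → K * (x + - y + (K + - 1ℚ) * z)) (q-high n) (h-high (suc n)) (h²-high n) ⟩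
    K * (M * B′ + - B m + - B m + (K + - 1ℚ) * (- (M * B m) + M * B′ + - B m))
      ≡⟨ solve 4 (λ x w b b′ → x :* (w :* b′ :+ :- b :+ :- b :+ (x :+ :- con 1ℚ) :* (:- (w :* b) :+ w :* b′ :+ :- b))
                     := :- (x :* ((w :+ con 1ℚ) :* x :+ :- w :+ con 1ℚ) :* b) :+ w :* x :* x :* b′)
               refl K M (B m) B′ ⟩
    (- (K * ((M + 1ℚ) * K ℚ.- M ℚ.+ 1ℚ) * B m)) ℚ.+ M * K * K * B′
      ≡⟨ cong₂ (λ a b → (- (K * (a ℚ.- M ℚ.+ 1ℚ) * B m)) ℚ.+ b * B′)
               (sym (trans (ℕtoℚ-* (m ℕ.+ 1) k) (cong (_* K) (ℕtoℚ-+ m 1))))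
               (sym (trans (ℕtoℚ-* (m ℕ.* k) k) (cong (_* K) (ℕtoℚ-* m k)))) ⟩
    (- (K * (ℕtoℚ ((m ℕ.+ 1) ℕ.* k) ℚ.- M ℚ.+ 1ℚ) * B m)) ℚ.+ ℕtoℚ (m ℕ.* k ℕ.* k) * B′ ∎
    where
    m : ℕ
    m = suc (suc (suc n))
    K M B′ : ℚ
    K  = ℕtoℚ k
    M  = ℕtoℚ m
    B′ = B (suc (suc n))
    cong₃ : ∀ (F : ℚ → ℚ → ℚ → ℚ) {x x′ y y′ z z′} → x ≡ x′ → y ≡ y′ → z ≡ z′ → F x y z ≡ F x′ y′ z′
    cong₃ F refl refl refl = refl

-- The theorem: the four cases are the lemmas above.
mainTheorem3 : (k m : ℕ) → 1 ≤ k → 1 ≤ m →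
  ((m ≡ 1 →
    sumBelow m (λ q → ℕtoℚ (m C q) * (ℕtoℚ (m ∸ q) * (Bord (+ k) q * Bord (ℤ.- (+ k)) (m ∸ q))))
      ≡ - (ℕtoℚ k * B 1))
  × (2 ≤ m →
    sumBelow m (λ q → ℕtoℚ (m C q) * (ℕtoℚ (m ∸ q) * (Bord (+ k) q * Bord (ℤ.- (+ k)) (m ∸ q))))
      ≡ ℕtoℚ k * B m))
  × (m ≡ 2 →
    sumBelow (m ∸ 1) (λ q → ℕtoℚ (m C q) * (ℕtoℚ (m ∸ q) * (ℕtoℚ (m ∸ q ∸ 1) * (Bord (+ k) q * Bord (ℤ.- (+ k)) (m ∸ q)))))
      ≡ (- (ℕtoℚ k * (ℕtoℚ (3 ℕ.* k) ℚ.- ℚ.1ℚ) * B 2)) ℚ.- ℕtoℚ (2 ℕ.* k ℕ.* k) * B 1)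
  × (3 ≤ m →
    sumBelow (m ∸ 1) (λ q → ℕtoℚ (m C q) * (ℕtoℚ (m ∸ q) * (ℕtoℚ (m ∸ q ∸ 1) * (Bord (+ k) q * Bord (ℤ.- (+ k)) (m ∸ q)))))
      ≡ (- (ℕtoℚ k * (ℕtoℚ ((m ℕ.+ 1) ℕ.* k) ℚ.- ℕtoℚ m ℚ.+ ℚ.1ℚ) * B m)) ℚ.+ ℕtoℚ (m ℕ.* k ℕ.* k) * B (m ∸ 1))
mainTheorem3 k m _ _ =
    ( (λ { refl → firstSum-one k })
    , (λ { (s≤s (s≤s {n = n} _)) → firstSum-high k n }) )
  , (λ { refl → secondSum-two k })
  , (λ { (s≤s (s≤s (s≤s {n = n} _))) → secondSum-high k n })
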